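{- Let $p>5$ be a prime. Then $$\sum_{k=0}^{[p/4]}\frac{\binom{4k}{2k}}{(-16)^k}\equiv\begin{cases}(-1)^{\frac{p-1}8}2^{\frac{p-1}4}\pmod p&\text{if }p\equiv1\pmod 8,\\ (-1)^{\frac{p-3}8}2^{\frac{p-3}4}\pmod p&\text{if }p\equiv3\pmod8,\\ 0\pmod p&\text{if }p\equiv5\pmod 8,\\ (-1)^{\frac{p+1}8}2^{\frac{p-3}4}\pmod p&\text{if }p\equiv7\pmod8.\end{cases}$$
   Context: $[x]$ is the greatest integer not exceeding $x$. -}

module Defs where

open import Data.Nat as ℕ using (ℕ; zero; suc)
open import Data.Nat.Properties using (m^n≢0)
open import Data.Nat.Combinatorics using (_C_)
open import Data.Integer as ℤ using (ℤ; +_; -[1+_])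
open import Data.Integer.Divisibility as ℤDiv using ()
open import Data.Rational as ℚ using (ℚ; ↥_)

-- The k-th summand  binom(4k,2k) / (-16)^k  =  ((-1)^k * binom(4k,2k)) / 16^k  as a rational.
term : ℕ → ℚ
term k = (((-[1+ 0 ]) ℤ.^ k) ℤ.* (+ ((4 ℕ.* k) C (2 ℕ.* k)))) ℚ./ (16 ℕ.^ k)
  where instance _ = m^n≢0 16 k

S : ℕ → ℚ
S zero    = term zero
S (suc n) = S n ℚ.+ term (suc n)

-- Congruence of rationals modulo a prime p: x ≡ y (mod p) iff p divides the
-- numerator of x - y in lowest terms (i.e. x - y ∈ p ℤ_(p)).
_≡_[modℚ_] : ℚ → ℚ → ℕ → Set
x ≡ y [modℚ p ] = (+ p) ℤDiv.∣ (↥ (x ℚ.- y))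

toℚ : ℤ → ℚ
toℚ z = z ℚ./ 1

module Submission where

-- Let p = 2h + 1 be a prime.  Modulo p the central binomial coefficients satisfy
--   C(2j,j) ≡ (-4)^j C(h,j)   (j ≤ h),
-- since both sides obey (j+1) x_{j+1} ≡ 2(2j+1) x_j.  For j = 2k this reads
-- C(4k,2k)/16^k ≡ C(h,2k), so with n = ⌊p/4⌋ = ⌊h/2⌋ the sum of the theorem is
--   S n ≡ Σ_k (-1)^k C(h,2k) = Re (1+i)^h   (mod p).
-- As (1+i)^4 = -4, Re (1+i)^(4m+s) = (-4)^m Re (1+i)^s, and Re (1+i)^s = 1, 1, 0, -2 for
-- s = 0, 1, 2, 3; writing p = 8m + 2s + 1 gives the four cases.

open import Defs
open import Data.Nat as ℕ using (ℕ; zero; suc; _≤_; _<_; z≤n; s≤s)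
open import Data.Nat.Primality using (Prime)
open import Data.Nat.Combinatorics using (_C_)
open import Data.Product using (_×_; _,_; proj₁; proj₂)
open import Relation.Nullary using (¬_)
open import Relation.Binary.PropositionalEquality
  using (_≡_; refl; sym; trans; cong; cong₂; subst; subst₂; module ≡-Reasoning)
open ≡-Reasoning

module Binomial where

  open import Data.Nat using (_+_; _*_; _∸_)
  open import Data.Nat.Properties
    using (*-zeroʳ; *-identityʳ; +-identityʳ; *-cancelˡ-≡; m≤m+n; n≤1+n; ≤-trans; m+n∸n≡m)
  open import Data.Nat.Combinatorics using (nCk+nC[k+1]≡[n+1]C[k+1]; nC1≡n; nCk≡nC[n∸k])
  open import Data.Nat.Tactic.RingSolver using (solve-∀)

  pascal : ∀ n k → suc n C suc k ≡ n C k + n C suc k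
  pascal n k = sym (nCk+nC[k+1]≡[n+1]C[k+1] n k)

  twice-suc : ∀ k → 2 * suc k ≡ suc (suc (2 * k))
  twice-suc = solve-∀

  absorption : ∀ n k → suc k * (suc n C suc k) ≡ suc n * (n C k)
  absorption zero    zero    = refl
  absorption zero    (suc k) = *-zeroʳ (2 + k)
  absorption (suc n) zero    = begin
    1 * ((2 + n) C 1)   ≡⟨ +-identityʳ _ ⟩
    (2 + n) C 1         ≡⟨ nC1≡n (2 + n) ⟩
    2 + n               ≡⟨ *-identityʳ (2 + n) ⟨
    (2 + n) * 1         ∎
  absorption (suc n) (suc k) = begin
    (2 + k) * ((2 + n) C (2 + k))
      ≡⟨ cong ((2 + k) *_) (pascal (suc n) (suc k)) ⟩
    (2 + k) * ((1 + n) C (1 + k) + (1 + n) C (2 + k))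
      ≡⟨ split k ((1 + n) C (1 + k)) ((1 + n) C (2 + k)) ⟩
    (1 + k) * ((1 + n) C (1 + k)) + (1 + n) C (1 + k) + (2 + k) * ((1 + n) C (2 + k))
      ≡⟨ cong₂ (λ a b → a + (1 + n) C (1 + k) + b) (absorption n k) (absorption n (suc k)) ⟩
    (1 + n) * (n C k) + (1 + n) C (1 + k) + (1 + n) * (n C (1 + k))
      ≡⟨ regroup n (n C k) ((1 + n) C (1 + k)) (n C (1 + k)) ⟩
    (1 + n) * (n C k + n C (1 + k)) + (1 + n) C (1 + k)
      ≡⟨ cong (λ z → (1 + n) * z + (1 + n) C (1 + k)) (pascal n k) ⟨
    (1 + n) * ((1 + n) C (1 + k)) + (1 + n) C (1 + k)
      ≡⟨ collect n ((1 + n) C (1 + k)) ⟩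
    (2 + n) * ((1 + n) C (1 + k)) ∎
    where
    split : ∀ k a b → (2 + k) * (a + b) ≡ (1 + k) * a + a + (2 + k) * b
    split = solve-∀
    regroup : ∀ n a b c → (1 + n) * a + b + (1 + n) * c ≡ (1 + n) * (a + c) + b
    regroup = solve-∀
    collect : ∀ n a → (1 + n) * a + a ≡ (2 + n) * a
    collect = solve-∀

  -- Downward absorption in additive form:  (k+1) C(n,k+1) + k C(n,k) = n C(n,k),
  -- i.e. (k+1) C(n,k+1) = (n-k) C(n,k) without truncated subtraction.
  absorption-down : ∀ n k → suc k * (n C suc k) + k * (n C k) ≡ n * (n C k)
  absorption-down zero    zero    = refl
  absorption-down zero    (suc k) = cong₂ _+_ (*-zeroʳ (2 + k)) (*-zeroʳ (suc k))
  absorption-down (suc n) zero    = trans (+-identityʳ _) (trans (+-identityʳ _) (trans (nC1≡n (suc n)) (sym (*-identityʳ (suc n)))))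
  absorption-down (suc n) (suc k) = begin
    (2 + k) * ((1 + n) C (2 + k)) + (1 + k) * ((1 + n) C (1 + k))
      ≡⟨ cong₂ _+_ (absorption n (suc k)) (absorption n k) ⟩
    (1 + n) * (n C (1 + k)) + (1 + n) * (n C k)
      ≡⟨ factor n (n C (1 + k)) (n C k) ⟩
    (1 + n) * (n C k + n C (1 + k))
      ≡⟨ cong ((1 + n) *_) (pascal n k) ⟨
    (1 + n) * ((1 + n) C (1 + k)) ∎
    where
    factor : ∀ n a b → (1 + n) * a + (1 + n) * b ≡ (1 + n) * (b + a)
    factor = solve-∀

  central-ratio : ∀ j → suc j * ((2 * suc j) C suc j) ≡ 2 * (1 + 2 * j) * ((2 * j) C j)
  central-ratio j = *-cancelˡ-≡ _ _ (suc j) (begin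
    (1 + j) * ((1 + j) * ((2 * suc j) C (1 + j)))
      ≡⟨ cong (λ m → (1 + j) * ((1 + j) * (m C (1 + j)))) (twice-suc j) ⟩
    (1 + j) * ((1 + j) * ((2 + 2 * j) C (1 + j)))
      ≡⟨ cong ((1 + j) *_) (absorption (1 + 2 * j) j) ⟩
    (1 + j) * ((2 + 2 * j) * ((1 + 2 * j) C j))
      ≡⟨ cong (λ c → (1 + j) * ((2 + 2 * j) * c)) middle-symmetry ⟩
    (1 + j) * ((2 + 2 * j) * ((1 + 2 * j) C (1 + j)))
      ≡⟨ swap j ((1 + 2 * j) C (1 + j)) ⟩
    (2 + 2 * j) * ((1 + j) * ((1 + 2 * j) C (1 + j)))
      ≡⟨ cong ((2 + 2 * j) *_) (absorption (2 * j) j) ⟩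
    (2 + 2 * j) * ((1 + 2 * j) * ((2 * j) C j))
      ≡⟨ finish j ((2 * j) C j) ⟩
    (1 + j) * (2 * (1 + 2 * j) * ((2 * j) C j)) ∎)
    where
    swap : ∀ j a → (1 + j) * ((2 + 2 * j) * a) ≡ (2 + 2 * j) * ((1 + j) * a)
    swap = solve-∀
    finish : ∀ j a → (2 + 2 * j) * ((1 + 2 * j) * a) ≡ (1 + j) * (2 * (1 + 2 * j) * a)
    finish = solve-∀
    middle-symmetry : (1 + 2 * j) C j ≡ (1 + 2 * j) C (1 + j)
    middle-symmetry = trans (nCk≡nC[n∸k] (≤-trans (m≤m+n j (j + 0)) (n≤1+n (2 * j))))
                            (cong ((1 + 2 * j) C_) complement)
      where
      complement : (1 + 2 * j) ∸ j ≡ 1 + j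
      complement = trans (cong (_∸ j) (as-sum j)) (m+n∸n≡m (suc j) j)
        where
        as-sum : ∀ j → 1 + 2 * j ≡ (1 + j) + j
        as-sum = solve-∀

module Congruences where

  open Binomial using (central-ratio; absorption-down)
  open import Data.Nat.Properties using (≤-trans; <⇒≱; m≤m+n; n≤1+n)
  import Data.Nat.Divisibility as ℕ
  open import Data.Nat.Primality using (euclidsLemma; ¬prime[1])
  open import Data.Integer as ℤ using (ℤ; +_; -[1+_]; _+_; _*_; _-_; _^_)
  open import Data.Integer.Properties using (pos-*; abs-*)
  open import Data.Integer.Divisibility.Signed
    using (_∣_; divides; ∣-refl; ∣⇒∣ᵤ; ∣ᵤ⇒∣; ∣m∣n⇒∣m+n; ∣n⇒∣m*n; ∣m⇒∣m*n)
  open import Data.Integer.Tactic.RingSolver using (solve-∀)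
  open import Data.Sum as Sum using (_⊎_; inj₁; inj₂)
  open import Relation.Nullary using (contradiction)

  central-ratio-ℤ : ∀ j → (+ 1 + + j) * + ((2 ℕ.* suc j) C suc j) ≡ + 2 * (+ 1 + + 2 * + j) * + ((2 ℕ.* j) C j)
  central-ratio-ℤ j = begin
    + suc j * + ((2 ℕ.* suc j) C suc j)              ≡⟨ pos-* (suc j) _ ⟨
    + (suc j ℕ.* ((2 ℕ.* suc j) C suc j))            ≡⟨ cong +_ (central-ratio j) ⟩
    + (2 ℕ.* (1 ℕ.+ 2 ℕ.* j) ℕ.* ((2 ℕ.* j) C j))    ≡⟨ pos-* (2 ℕ.* (1 ℕ.+ 2 ℕ.* j)) _ ⟩
    + (2 ℕ.* (1 ℕ.+ 2 ℕ.* j)) * + ((2 ℕ.* j) C j)    ≡⟨ cong (_* + ((2 ℕ.* j) C j)) (pos-* 2 (1 ℕ.+ 2 ℕ.* j)) ⟩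
    + 2 * (+ 1 + + (2 ℕ.* j)) * + ((2 ℕ.* j) C j)    ≡⟨ cong (λ x → + 2 * (+ 1 + x) * + ((2 ℕ.* j) C j)) (pos-* 2 j) ⟩
    + 2 * (+ 1 + + 2 * + j) * + ((2 ℕ.* j) C j)      ∎

  absorption-down-ℤ : ∀ h j → (+ 1 + + j) * + (h C suc j) + + j * + (h C j) ≡ + h * + (h C j)
  absorption-down-ℤ h j = begin
    + suc j * + (h C suc j) + + j * + (h C j)         ≡⟨ cong₂ _+_ (pos-* (suc j) _) (pos-* j _) ⟨
    + (suc j ℕ.* (h C suc j) ℕ.+ j ℕ.* (h C j))       ≡⟨ cong +_ (absorption-down h j) ⟩
    + (h ℕ.* (h C j))                                ≡⟨ pos-* h _ ⟩
    + h * + (h C j)                                  ∎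

  -- One step of the congruence: writing a = C(2j,j), c = C(2j+2,j+1), b = C(h,j), b′ = C(h,j+1),
  -- w = (-4)^j, the identities above give
  --   (j+1)(c - (-4) w b′) = 2(2j+1)(a - w b) + (2h+1)(2 w b).
  central-step : ∀ J H a b c b′ w →
                 (+ 1 + J) * c ≡ + 2 * (+ 1 + + 2 * J) * a →
                 (+ 1 + J) * b′ + J * b ≡ H * b →
                 (+ 1 + J) * (c - -[1+ 3 ] * w * b′) ≡ + 2 * (+ 1 + + 2 * J) * (a - w * b) + (+ 1 + + 2 * H) * (+ 2 * w * b)
  central-step J H a b c b′ w ratio absorb = begin
    (+ 1 + J) * (c - -[1+ 3 ] * w * b′)
      ≡⟨ expand J c w b′ b ⟩
    (+ 1 + J) * c - -[1+ 3 ] * w * ((+ 1 + J) * b′ + J * b) + -[1+ 3 ] * w * J * b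
      ≡⟨ cong₂ (λ x y → x - -[1+ 3 ] * w * y + -[1+ 3 ] * w * J * b) ratio absorb ⟩
    + 2 * (+ 1 + + 2 * J) * a - -[1+ 3 ] * w * (H * b) + -[1+ 3 ] * w * J * b
      ≡⟨ collect J H a w b ⟩
    + 2 * (+ 1 + + 2 * J) * (a - w * b) + (+ 1 + + 2 * H) * (+ 2 * w * b) ∎
    where
    expand : ∀ J c w b′ b → (+ 1 + J) * (c - -[1+ 3 ] * w * b′)
             ≡ (+ 1 + J) * c - -[1+ 3 ] * w * ((+ 1 + J) * b′ + J * b) + -[1+ 3 ] * w * J * b
    expand = solve-∀
    collect : ∀ J H a w b → + 2 * (+ 1 + + 2 * J) * a - -[1+ 3 ] * w * (H * b) + -[1+ 3 ] * w * J * b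
              ≡ + 2 * (+ 1 + + 2 * J) * (a - w * b) + (+ 1 + + 2 * H) * (+ 2 * w * b)
    collect = solve-∀

  module _ {p : ℕ} (p-prime : Prime p) where

    euclid : ∀ a b → + p ∣ a * b → + p ∣ a ⊎ + p ∣ b
    euclid a b p∣ab = Sum.map ∣ᵤ⇒∣ ∣ᵤ⇒∣
      (euclidsLemma ℤ.∣ a ∣ ℤ.∣ b ∣ p-prime (subst (p ℕ.∣_) (abs-* a b) (∣⇒∣ᵤ p∣ab)))

    ∤-* : ∀ {a b} → ¬ + p ∣ a → ¬ + p ∣ b → ¬ + p ∣ a * b
    ∤-* {a} {b} p∤a p∤b p∣ab with euclid a b p∣ab
    ... | inj₁ p∣a = p∤a p∣a
    ... | inj₂ p∣b = p∤b p∣b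

    ∤-1 : ¬ + p ∣ + 1
    ∤-1 p∣1 = ¬prime[1] (subst Prime (ℕ.∣1⇒≡1 (∣⇒∣ᵤ p∣1)) p-prime)

    ∤-^ : ∀ {m} → ¬ + p ∣ + m → ∀ k → ¬ + p ∣ + (m ℕ.^ k)
    ∤-^     p∤m zero    = ∤-1
    ∤-^ {m} p∤m (suc k) = subst (λ x → ¬ + p ∣ x) (sym (pos-* m (m ℕ.^ k))) (∤-* p∤m (∤-^ p∤m k))

    ∤-below : ∀ {n} → 0 < n → n < p → ¬ + p ∣ + n
    ∤-below {suc n} _ n<p p∣n = <⇒≱ n<p (ℕ.∣⇒≤ (∣⇒∣ᵤ p∣n))

    cancel : ∀ {n z} → 0 < n → n < p → + p ∣ + n * z → + p ∣ z
    cancel {n} {z} 0<n n<p p∣nz with euclid (+ n) z p∣nz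
    ... | inj₁ p∣n = contradiction p∣n (∤-below 0<n n<p)
    ... | inj₂ p∣z = p∣z

    central-mod : ∀ {h} → p ≡ suc (2 ℕ.* h) → ∀ j → j ≤ h →
                  + p ∣ + ((2 ℕ.* j) C j) - -[1+ 3 ] ^ j * + (h C j)
    central-mod _        zero    _     = divides (+ 0) refl
    central-mod {h} p≡2h+1 (suc j) 1+j≤h = cancel (s≤s z≤n) 1+j<p
      (subst (+ p ∣_) (sym step)
        (∣m∣n⇒∣m+n (∣n⇒∣m*n (+ 2 * (+ 1 + + 2 * + j)) (central-mod p≡2h+1 j (≤-trans (n≤1+n j) 1+j≤h)))
                   (∣m⇒∣m*n (+ 2 * w * b) ∣-refl)))
      where
      b = + (h C j)
      w = -[1+ 3 ] ^ j
      1+j<p : suc j < p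
      1+j<p = subst (suc j <_) (sym p≡2h+1) (s≤s (≤-trans 1+j≤h (m≤m+n h (h ℕ.+ 0))))
      p-ℤ : + 1 + + 2 * + h ≡ + p
      p-ℤ = sym (trans (cong +_ p≡2h+1) (cong (_+_ (+ 1)) (pos-* 2 h)))
      step : + suc j * (+ ((2 ℕ.* suc j) C suc j) - -[1+ 3 ] * w * + (h C suc j))
             ≡ + 2 * (+ 1 + + 2 * + j) * (+ ((2 ℕ.* j) C j) - w * b) + + p * (+ 2 * w * b)
      step = trans
               (central-step (+ j) (+ h) (+ ((2 ℕ.* j) C j)) b (+ ((2 ℕ.* suc j) C suc j)) (+ (h C suc j)) w
                             (central-ratio-ℤ j) (absorption-down-ℤ h j))
               (cong (λ q → + 2 * (+ 1 + + 2 * + j) * (+ ((2 ℕ.* j) C j) - w * b) + q * (+ 2 * w * b)) p-ℤ)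


module GaussianSums where

  open Binomial using (pascal; twice-suc)
  open import Function using (_∘_)
  open import Data.Nat.Properties using (m≤n+m; m≤m+n; ≤-trans; <-≤-trans; n≤1+n)
  open import Data.Nat.Combinatorics using (k>n⇒nCk≡0)
  open import Data.Integer as ℤ using (ℤ; +_; -[1+_]; _+_; _*_; _-_; _^_)
  open import Data.Integer.Properties using (+-identityʳ; *-zeroʳ; *-identityˡ; *-assoc)
  open import Data.Integer.Tactic.RingSolver using (solve-∀)

  Σ≤ : (ℕ → ℤ) → ℕ → ℤ
  Σ≤ f zero    = f zero
  Σ≤ f (suc N) = Σ≤ f N + f (suc N)

  Σ≤-stable : ∀ f N → (∀ k → N < k → f k ≡ + 0) → ∀ a → Σ≤ f (a ℕ.+ N) ≡ Σ≤ f N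
  Σ≤-stable f N vanish zero    = refl
  Σ≤-stable f N vanish (suc a) = begin
    Σ≤ f (a ℕ.+ N) + f (suc (a ℕ.+ N)) ≡⟨ cong (_+_ (Σ≤ f (a ℕ.+ N))) (vanish _ (s≤s (m≤n+m N a))) ⟩
    Σ≤ f (a ℕ.+ N) + + 0               ≡⟨ +-identityʳ _ ⟩
    Σ≤ f (a ℕ.+ N)                     ≡⟨ Σ≤-stable f N vanish a ⟩
    Σ≤ f N                             ∎

  sign : ℕ → ℤ
  sign k = -[1+ 0 ] ^ k

  evenTerm oddTerm : ℕ → ℕ → ℤ
  evenTerm h k = sign k * + (h C (2 ℕ.* k))
  oddTerm  h k = sign k * + (h C suc (2 ℕ.* k))

  evenSum oddSum : ℕ → ℕ → ℤ
  evenSum h = Σ≤ (evenTerm h)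
  oddSum  h = Σ≤ (oddTerm h)

  evenTerm-suc : ∀ h k → evenTerm (suc h) (suc k) ≡ evenTerm h (suc k) - oddTerm h k
  evenTerm-suc h k = begin
    sign (suc k) * + (suc h C (2 ℕ.* suc k))
      ≡⟨ cong (λ i → sign (suc k) * + (suc h C i)) (twice-suc k) ⟩
    sign (suc k) * + (suc h C suc (suc (2 ℕ.* k)))
      ≡⟨ cong (λ n → sign (suc k) * + n) (pascal h (suc (2 ℕ.* k))) ⟩
    sign (suc k) * (+ (h C suc (2 ℕ.* k)) + + (h C suc (suc (2 ℕ.* k))))
      ≡⟨ cong (λ i → sign (suc k) * (+ (h C suc (2 ℕ.* k)) + + (h C i))) (twice-suc k) ⟨
    sign (suc k) * (+ (h C suc (2 ℕ.* k)) + + (h C (2 ℕ.* suc k)))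
      ≡⟨ distribute (sign k) _ _ ⟩
    evenTerm h (suc k) - oddTerm h k ∎
    where
    distribute : ∀ s o e → (-[1+ 0 ] * s) * (o + e) ≡ (-[1+ 0 ] * s) * e - s * o
    distribute = solve-∀

  oddTerm-suc : ∀ h k → oddTerm (suc h) k ≡ oddTerm h k + evenTerm h k
  oddTerm-suc h k = begin
    sign k * + (suc h C suc (2 ℕ.* k))
      ≡⟨ cong (λ n → sign k * + n) (pascal h (2 ℕ.* k)) ⟩
    sign k * (+ (h C (2 ℕ.* k)) + + (h C suc (2 ℕ.* k)))
      ≡⟨ distribute (sign k) _ _ ⟩
    oddTerm h k + evenTerm h k ∎
    where
    distribute : ∀ s e o → s * (e + o) ≡ s * o + s * e
    distribute = solve-∀

  evenSum-suc : ∀ h N → evenSum (suc h) (suc N) ≡ evenSum h (suc N) - oddSum h N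
  evenSum-suc h zero    = trans (cong (_+_ (evenTerm h 0)) (evenTerm-suc h 0))
                                (regroup (evenTerm h 0) (evenTerm h 1) (oddTerm h 0))
    where
    regroup : ∀ a b c → a + (b - c) ≡ a + b - c
    regroup = solve-∀
  evenSum-suc h (suc N) = trans (cong₂ _+_ (evenSum-suc h N) (evenTerm-suc h (suc N)))
                                  (regroup (evenSum h (suc N)) (oddSum h N) (evenTerm h (2 ℕ.+ N)) (oddTerm h (suc N)))
    where
    regroup : ∀ a b c d → (a - b) + (c - d) ≡ (a + c) - (b + d)
    regroup = solve-∀

  oddSum-suc : ∀ h N → oddSum (suc h) N ≡ oddSum h N + evenSum h N
  oddSum-suc h zero    = oddTerm-suc h 0
  oddSum-suc h (suc N) = trans (cong₂ _+_ (oddSum-suc h N) (oddTerm-suc h (suc N)))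
                                 (regroup (oddSum h N) (evenSum h N) (oddTerm h (suc N)) (evenTerm h (suc N)))
    where
    regroup : ∀ a b c d → (a + b) + (c + d) ≡ (a + c) + (b + d)
    regroup = solve-∀

  evenTerm-vanish : ∀ h k → h < 2 ℕ.* k → evenTerm h k ≡ + 0
  evenTerm-vanish h k h<2k = trans (cong (λ n → sign k * + n) (k>n⇒nCk≡0 h<2k)) (*-zeroʳ (sign k))

  oddTerm-vanish : ∀ h k → h < suc (2 ℕ.* k) → oddTerm h k ≡ + 0
  oddTerm-vanish h k h<2k+1 = trans (cong (λ n → sign k * + n) (k>n⇒nCk≡0 h<2k+1)) (*-zeroʳ (sign k))

  k≤2k : ∀ k → k ≤ 2 ℕ.* k
  k≤2k k = m≤m+n k (k ℕ.+ 0)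

  evenTerm-beyond : ∀ h k → h < k → evenTerm h k ≡ + 0
  evenTerm-beyond h k h<k = evenTerm-vanish h k (<-≤-trans h<k (k≤2k k))

  oddTerm-beyond : ∀ h k → h < k → oddTerm h k ≡ + 0
  oddTerm-beyond h k h<k = oddTerm-vanish h k (<-≤-trans h<k (≤-trans (k≤2k k) (n≤1+n _)))

  -- (1+i)^h = re h + i·im h, read off from the binomial theorem.
  re im : ℕ → ℤ
  re h = evenSum h h
  im h = oddSum  h h

  re-suc : ∀ h → re (suc h) ≡ re h - im h
  re-suc h = begin
    evenSum (suc h) (suc h)      ≡⟨ evenSum-suc h h ⟩
    evenSum h (suc h) - oddSum h h ≡⟨ cong (_- im h) (Σ≤-stable (evenTerm h) h (evenTerm-beyond h) 1) ⟩
    re h - im h                  ∎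

  im-suc : ∀ h → im (suc h) ≡ im h + re h
  im-suc h = begin
    oddSum (suc h) (suc h)            ≡⟨ oddSum-suc h (suc h) ⟩
    oddSum h (suc h) + evenSum h (suc h) ≡⟨ cong₂ _+_ (Σ≤-stable (oddTerm h) h (oddTerm-beyond h) 1)
                                                      (Σ≤-stable (evenTerm h) h (evenTerm-beyond h) 1) ⟩
    im h + re h                       ∎

  -- Gaussian integers as pairs (real part, imaginary part).
  _·[1+i] : ℤ × ℤ → ℤ × ℤ
  (x , y) ·[1+i] = x - y , y + x

  _•_ : ℤ → ℤ × ℤ → ℤ × ℤ
  c • (x , y) = c * x , c * y

  ·[1+i]⁴ : ∀ v → v ·[1+i] ·[1+i] ·[1+i] ·[1+i] ≡ -[1+ 3 ] • v
  ·[1+i]⁴ (x , y) = cong₂ _,_ (real x y) (imaginary x y)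
    where
    real : ∀ x y → ((x - y) - (y + x)) - ((y + x) + (x - y)) - (((y + x) + (x - y)) + ((x - y) - (y + x))) ≡ -[1+ 3 ] * x
    real = solve-∀
    imaginary : ∀ x y → (((y + x) + (x - y)) + ((x - y) - (y + x))) + (((x - y) - (y + x)) - ((y + x) + (x - y))) ≡ -[1+ 3 ] * y
    imaginary = solve-∀

  •-assoc : ∀ a b v → a • (b • v) ≡ (a * b) • v
  •-assoc a b (x , y) = cong₂ _,_ (sym (*-assoc a b x)) (sym (*-assoc a b y))

  [1+i]^ : ℕ → ℤ × ℤ
  [1+i]^ h = re h , im h

  [1+i]^-suc : ∀ h → [1+i]^ (suc h) ≡ [1+i]^ h ·[1+i]
  [1+i]^-suc h = cong₂ _,_ (re-suc h) (im-suc h)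

  [1+i]^-4+ : ∀ h → [1+i]^ (4 ℕ.+ h) ≡ -[1+ 3 ] • [1+i]^ h
  [1+i]^-4+ h = begin
    [1+i]^ (4 ℕ.+ h)                                      ≡⟨ [1+i]^-suc (3 ℕ.+ h) ⟩
    [1+i]^ (3 ℕ.+ h) ·[1+i]                               ≡⟨ cong _·[1+i] ([1+i]^-suc (2 ℕ.+ h)) ⟩
    [1+i]^ (2 ℕ.+ h) ·[1+i] ·[1+i]                        ≡⟨ cong (_·[1+i] ∘ _·[1+i]) ([1+i]^-suc (1 ℕ.+ h)) ⟩
    [1+i]^ (1 ℕ.+ h) ·[1+i] ·[1+i] ·[1+i]                 ≡⟨ cong (_·[1+i] ∘ _·[1+i] ∘ _·[1+i]) ([1+i]^-suc h) ⟩
    [1+i]^ h ·[1+i] ·[1+i] ·[1+i] ·[1+i]                  ≡⟨ ·[1+i]⁴ ([1+i]^ h) ⟩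
    -[1+ 3 ] • [1+i]^ h                                   ∎

  [1+i]^-period : ∀ m s → [1+i]^ (m ℕ.* 4 ℕ.+ s) ≡ (-[1+ 3 ] ^ m) • [1+i]^ s
  [1+i]^-period zero    s = sym (cong₂ _,_ (*-identityˡ (re s)) (*-identityˡ (im s)))
  [1+i]^-period (suc m) s = begin
    [1+i]^ (4 ℕ.+ (m ℕ.* 4 ℕ.+ s))              ≡⟨ [1+i]^-4+ (m ℕ.* 4 ℕ.+ s) ⟩
    -[1+ 3 ] • [1+i]^ (m ℕ.* 4 ℕ.+ s)           ≡⟨ cong (-[1+ 3 ] •_) ([1+i]^-period m s) ⟩
    -[1+ 3 ] • ((-[1+ 3 ] ^ m) • [1+i]^ s)      ≡⟨ •-assoc -[1+ 3 ] (-[1+ 3 ] ^ m) ([1+i]^ s) ⟩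
    (-[1+ 3 ] ^ suc m) • [1+i]^ s               ∎

module p-Integral {p : ℕ} (p-prime : Prime p) where

  open Congruences using (euclid; ∤-*; ∤-1)
  open import Data.Nat using (NonZero)
  open import Data.Integer as ℤ using (ℤ; +_; _+_; _*_; _-_; -_)
  open import Data.Integer.Properties using (*-cancelʳ-≡)
  open import Data.Integer.Divisibility.Signed
    using (_∣_; divides; ∣⇒∣ᵤ; ∣m∣n⇒∣m+n; ∣n⇒∣m*n; ∣m⇒∣m*n; ∣m⇒∣-m)
  import Data.Integer.Divisibility as ℤᵘ
  open import Data.Integer.Tactic.RingSolver using (solve-∀)
  open import Data.Integer.GCD using (gcd)
  open import Data.Rational as ℚ using (↥_; ↧_; toℚᵘ)
  open import Data.Rational.Properties using (↥ᵘ-toℚᵘ; ↧ᵘ-toℚᵘ; ↥-/; ↧-/; toℚᵘ-homo-+; toℚᵘ-homo‿-)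
  open import Data.Rational.Unnormalised as ℚᵘ using (ℚᵘ; mkℚᵘ; *≡*; _≃_)
    renaming (↥_ to ↥ᵘ_; ↧_ to ↧ᵘ_)
  open import Data.Sum using (inj₁; inj₂)
  open import Relation.Nullary using (contradiction)

  -- u ≋ c : the rational u is p-integral and congruent to the integer c modulo p,
  -- witnessed by a representation u = a/d with p ∤ d and a ≡ d·c (mod p).
  infix 4 _≋_
  record _≋_ (u : ℚᵘ) (c : ℤ) : Set where
    constructor _/_[_,_,_]
    field
      num den   : ℤ
      value     : ↥ᵘ u * den ≡ num * ↧ᵘ u
      den-unit  : ¬ + p ∣ den
      congruent : + p ∣ num - den * c

  ≋-resp-≃ : ∀ {u v c} → u ≃ v → v ≋ c → u ≋ c
  ≋-resp-≃ {u} {v@(mkℚᵘ n e)} (*≡* u≃v) (a / d [ v≡a/d , p∤d , p∣a-dc ]) =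
    a / d [ *-cancelʳ-≡ (↥ᵘ u * d) (a * ↧ᵘ u) (↧ᵘ v) cross , p∤d , p∣a-dc ]
    where
    cross : ↥ᵘ u * d * ↧ᵘ v ≡ a * ↧ᵘ u * ↧ᵘ v
    cross = begin
      ↥ᵘ u * d * ↧ᵘ v     ≡⟨ swap (↥ᵘ u) d (↧ᵘ v) ⟩
      ↥ᵘ u * ↧ᵘ v * d     ≡⟨ cong (_* d) u≃v ⟩
      n * ↧ᵘ u * d        ≡⟨ swap n (↧ᵘ u) d ⟩
      n * d * ↧ᵘ u        ≡⟨ cong (_* ↧ᵘ u) v≡a/d ⟩
      a * ↧ᵘ v * ↧ᵘ u     ≡⟨ swap a (↧ᵘ v) (↧ᵘ u) ⟩
      a * ↧ᵘ u * ↧ᵘ v     ∎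
      where
      swap : ∀ x y z → x * y * z ≡ x * z * y
      swap = solve-∀

  ≋-+ : ∀ {u v c c′} → u ≋ c → v ≋ c′ → (u ℚᵘ.+ v) ≋ (c + c′)
  ≋-+ {mkℚᵘ n₁ e₁} {mkℚᵘ n₂ e₂} {c} {c′} (a / d [ u≡a/d , p∤d , p∣a-dc ]) (b / e [ v≡b/e , p∤e , p∣b-ec′ ]) =
    (a * e + b * d) / (d * e)
      [ value
      , ∤-* p-prime p∤d p∤e
      , subst (+ p ∣_) (sym (rearrange a b c c′ d e)) (∣m∣n⇒∣m+n (∣n⇒∣m*n e p∣a-dc) (∣n⇒∣m*n d p∣b-ec′)) ]
    where
    D₁ = + suc e₁
    D₂ = + suc e₂
    rearrange : ∀ a b c c′ d e → a * e + b * d - d * e * (c + c′) ≡ e * (a - d * c) + d * (b - e * c′)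
    rearrange = solve-∀
    value : (n₁ * D₂ + n₂ * D₁) * (d * e) ≡ (a * e + b * d) * (D₁ * D₂)
    value = begin
      (n₁ * D₂ + n₂ * D₁) * (d * e)               ≡⟨ spread n₁ n₂ D₁ D₂ d e ⟩
      (n₁ * d) * (D₂ * e) + (n₂ * e) * (D₁ * d)   ≡⟨ cong₂ (λ x y → x * (D₂ * e) + y * (D₁ * d)) u≡a/d v≡b/e ⟩
      (a * D₁) * (D₂ * e) + (b * D₂) * (D₁ * d)   ≡⟨ collect a b D₁ D₂ d e ⟩
      (a * e + b * d) * (D₁ * D₂)                 ∎
      where
      spread : ∀ n₁ n₂ D₁ D₂ d e → (n₁ * D₂ + n₂ * D₁) * (d * e) ≡ (n₁ * d) * (D₂ * e) + (n₂ * e) * (D₁ * d)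
      spread = solve-∀
      collect : ∀ a b D₁ D₂ d e → (a * D₁) * (D₂ * e) + (b * D₂) * (D₁ * d) ≡ (a * e + b * d) * (D₁ * D₂)
      collect = solve-∀

  ≋-neg : ∀ {u c} → u ≋ c → (ℚᵘ.- u) ≋ (- c)
  ≋-neg {mkℚᵘ n e} {c} (a / d [ u≡a/d , p∤d , p∣a-dc ]) =
    (- a) / d [ value , p∤d , subst (+ p ∣_) (sym (negate a d c)) (∣m⇒∣-m p∣a-dc) ]
    where
    negate : ∀ a d c → - a - d * (- c) ≡ - (a - d * c)
    negate = solve-∀
    value : (- n) * d ≡ (- a) * + suc e
    value = begin
      (- n) * d        ≡⟨ neg-out n d ⟩
      - (n * d)        ≡⟨ cong -_ u≡a/d ⟩
      - (a * + suc e)  ≡⟨ neg-out a (+ suc e) ⟨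
      (- a) * + suc e  ∎
      where
      neg-out : ∀ x y → (- x) * y ≡ - (x * y)
      neg-out = solve-∀

  ≋-fraction : ∀ i n .{{_ : NonZero n}} {c} → ¬ + p ∣ + n → + p ∣ i - + n * c → toℚᵘ (i ℚ./ n) ≋ c
  ≋-fraction i n p∤n p∣i-nc = i / + n [ value , p∤n , p∣i-nc ]
    where
    q = i ℚ./ n
    g = gcd i (+ n)
    value : ↥ᵘ toℚᵘ q * + n ≡ i * ↧ᵘ toℚᵘ q
    value = begin
      ↥ᵘ toℚᵘ q * + n         ≡⟨ cong (_* + n) (↥ᵘ-toℚᵘ q) ⟩
      ↥ q * + n               ≡⟨ cong (↥ q *_) (↧-/ i n) ⟨
      ↥ q * (↧ q * g)         ≡⟨ swap (↥ q) (↧ q) g ⟩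
      (↥ q * g) * ↧ q         ≡⟨ cong (_* ↧ q) (↥-/ i n) ⟩
      i * ↧ q                 ≡⟨ cong (i *_) (↧ᵘ-toℚᵘ q) ⟨
      i * ↧ᵘ toℚᵘ q           ∎
      where
      swap : ∀ x y z → x * (y * z) ≡ (x * z) * y
      swap = solve-∀

  ≋-integer : ∀ c → toℚᵘ (toℚ c) ≋ c
  ≋-integer c = ≋-fraction c 1 (∤-1 p-prime) (subst (+ p ∣_) (sym (vanish c)) (divides (+ 0) refl))
    where
    vanish : ∀ c → c - + 1 * c ≡ + 0
    vanish = solve-∀

  ≋-zero : ∀ x → toℚᵘ x ≋ + 0 → (+ p) ℤᵘ.∣ ↥ x
  ≋-zero x (a / d [ x≡a/d , p∤d , p∣a-d0 ]) with euclid p-prime (↥ x) d p∣xd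
    where
    p∣a : + p ∣ a
    p∣a = subst (+ p ∣_) (minus-zero a d) p∣a-d0
      where
      minus-zero : ∀ a d → a - d * + 0 ≡ a
      minus-zero = solve-∀
    p∣xd : + p ∣ ↥ x * d
    p∣xd = subst (+ p ∣_) (sym (subst₂ (λ n m → n * d ≡ a * m) (↥ᵘ-toℚᵘ x) (↧ᵘ-toℚᵘ x) x≡a/d)) (∣m⇒∣m*n (↧ x) p∣a)
  ... | inj₁ p∣x = ∣⇒∣ᵤ p∣x
  ... | inj₂ p∣d = contradiction p∣d p∤d

  ≋⇒≡[modℚ] : ∀ x c → toℚᵘ x ≋ c → x ≡ toℚ c [modℚ p ]
  ≋⇒≡[modℚ] x c x≋c = ≋-zero (x ℚ.- toℚ c) (subst (toℚᵘ (x ℚ.- toℚ c) ≋_) (cancel c) difference)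
    where
    cancel : ∀ c → c + - c ≡ + 0
    cancel = solve-∀
    difference : toℚᵘ (x ℚ.- toℚ c) ≋ (c + - c)
    difference = ≋-resp-≃ (toℚᵘ-homo-+ x (ℚ.- toℚ c))
                   (≋-+ x≋c (≋-resp-≃ (toℚᵘ-homo‿- (toℚ c)) (≋-neg (≋-integer c))))


open Binomial using (twice-suc)
open Congruences using (∤-^; ∤-below; central-mod)
open GaussianSums
open import Data.Nat as ℕ using (_%_; _/_; _∸_)
open import Data.Nat.Properties
  using (m^n≢0; ≤-trans; <-trans; n≤1+n; m∸n+n≡m; *-monoʳ-≤; *-comm; +-monoˡ-≤; ≤-pred)
open import Data.Nat.DivMod
  using (m/n*n≤m; m%n<n; m≡m%n+[m/n]*n; m*n/n≡m; m<n⇒m/n≡0; +-distrib-/-∣ʳ; m/n/o≡m/[n*o])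
open import Data.Nat.Divisibility using (n∣m*n)
import Data.Nat.Tactic.RingSolver as ℕ-Solver
open import Data.Integer as ℤ using (ℤ; +_; -[1+_]; _+_; _*_; _-_; _^_)
open import Data.Integer.Properties using (pos-*; ^-*-assoc; *-identityʳ; *-zeroʳ)
open import Data.Integer.Divisibility.Signed using (_∣_; ∣n⇒∣m*n)
open import Data.Integer.Tactic.RingSolver using (solve-∀)
open import Data.Rational as ℚ using (toℚᵘ)
open import Data.Rational.Properties using (toℚᵘ-homo-+)

pos-^ : ∀ m k → + (m ℕ.^ k) ≡ (+ m) ^ k
pos-^ m zero    = refl
pos-^ m (suc k) = trans (pos-* m (m ℕ.^ k)) (cong (+ m *_) (pos-^ m k))

[-4]^[2k] : ∀ k → -[1+ 3 ] ^ (2 ℕ.* k) ≡ + (16 ℕ.^ k)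
[-4]^[2k] k = trans (sym (^-*-assoc -[1+ 3 ] 2 k)) (sym (pos-^ 16 k))

[-4]^ : ∀ m → -[1+ 3 ] ^ m ≡ sign m * (+ 2) ^ (2 ℕ.* m)
[-4]^ zero    = refl
[-4]^ (suc m) = begin
  -[1+ 3 ] * -[1+ 3 ] ^ m                           ≡⟨ cong (-[1+ 3 ] *_) ([-4]^ m) ⟩
  -[1+ 3 ] * (sign m * (+ 2) ^ (2 ℕ.* m))             ≡⟨ split (sign m) ((+ 2) ^ (2 ℕ.* m)) ⟩
  sign (suc m) * (+ 2) ^ (2 ℕ.+ 2 ℕ.* m)              ≡⟨ cong (λ e → sign (suc m) * (+ 2) ^ e) (twice-suc m) ⟨
  sign (suc m) * (+ 2) ^ (2 ℕ.* suc m)                ∎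
  where
  split : ∀ s x → -[1+ 3 ] * (s * x) ≡ (-[1+ 0 ] * s) * (+ 2 * (+ 2 * x))
  split = solve-∀

module _ {p : ℕ} (p-prime : Prime p) (2<p : 2 < p) where
  open p-Integral p-prime

  p∤16^ : ∀ k → ¬ + p ∣ + (16 ℕ.^ k)
  p∤16^ = ∤-^ p-prime (∤-^ p-prime (∤-below p-prime (s≤s z≤n) 2<p) 4)

  module _ {h : ℕ} (p≡2h+1 : p ≡ suc (2 ℕ.* h)) where

    -- Each summand  (-1)^k C(4k,2k)/16^k  of S is congruent to (-1)^k C(h,2k), since
    -- C(4k,2k) ≡ (-4)^(2k) C(h,2k) = 16^k C(h,2k).
    term≋ : ∀ k → 2 ℕ.* k ≤ h → toℚᵘ (term k) ≋ evenTerm h k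
    term≋ k 2k≤h = ≋-fraction (sign k * X) (16 ℕ.^ k) {{m^n≢0 16 k}} (p∤16^ k)
      (subst (+ p ∣_) (factor (sign k) X (+ (16 ℕ.^ k)) Y) (∣n⇒∣m*n (sign k) central))
      where
      X = + ((4 ℕ.* k) C (2 ℕ.* k))
      Y = + (h C (2 ℕ.* k))
      central : + p ∣ X - + (16 ℕ.^ k) * Y
      central = subst₂ (λ n w → + p ∣ + (n C (2 ℕ.* k)) - w * Y) (double-twice k) ([-4]^[2k] k)
                  (central-mod p-prime p≡2h+1 (2 ℕ.* k) 2k≤h)
        where
        double-twice : ∀ k → 2 ℕ.* (2 ℕ.* k) ≡ 4 ℕ.* k
        double-twice = ℕ-Solver.solve-∀
      factor : ∀ s x n y → s * (x - n * y) ≡ s * x - n * (s * y)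
      factor = solve-∀

    S≋ : ∀ n → 2 ℕ.* n ≤ h → toℚᵘ (S n) ≋ evenSum h n
    S≋ zero    0≤h    = term≋ 0 0≤h
    S≋ (suc n) 2n+2≤h = ≋-resp-≃ (toℚᵘ-homo-+ (S n) (term (suc n)))
      (≋-+ (S≋ n (≤-trans (*-monoʳ-≤ 2 (n≤1+n n)) 2n+2≤h)) (term≋ (suc n) 2n+2≤h))

[r+qd]/d≡q : ∀ r q d .{{_ : ℕ.NonZero d}} → r < d → (r ℕ.+ q ℕ.* d) / d ≡ q
[r+qd]/d≡q r q d r<d = trans (+-distrib-/-∣ʳ r (n∣m*n q)) (cong₂ ℕ._+_ (m<n⇒m/n≡0 r<d) (m*n/n≡m q d))

quarter≡half : ∀ h → suc (2 ℕ.* h) / 4 ≡ h / 2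
quarter≡half h = begin
  suc (2 ℕ.* h) / 4          ≡⟨ cong (_/ 4) (as-quotient h) ⟩
  (1 ℕ.+ h ℕ.* 2) / 4        ≡⟨ m/n/o≡m/[n*o] (1 ℕ.+ h ℕ.* 2) 2 2 ⟨
  (1 ℕ.+ h ℕ.* 2) / 2 / 2    ≡⟨ cong (_/ 2) ([r+qd]/d≡q 1 h 2 (s≤s (s≤s z≤n))) ⟩
  h / 2                      ∎
  where
  as-quotient : ∀ h → suc (2 ℕ.* h) ≡ 1 ℕ.+ h ℕ.* 2
  as-quotient = ℕ-Solver.solve-∀

half-bounds : ∀ h → 2 ℕ.* (h / 2) ≤ h × h ≤ suc (2 ℕ.* (h / 2))
half-bounds h =
    subst (_≤ h) (*-comm (h / 2) 2) (m/n*n≤m h 2)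
  , subst (h ≤_) (cong suc (*-comm (h / 2) 2))
      (subst (_≤ suc (h / 2 ℕ.* 2)) (sym (m≡m%n+[m/n]*n h 2)) (+-monoˡ-≤ (h / 2 ℕ.* 2) (≤-pred (m%n<n h 2))))

S≡re : ∀ {p h} → Prime p → 2 < p → p ≡ suc (2 ℕ.* h) → S (p / 4) ≡ toℚ (re h) [modℚ p ]
S≡re {h = h} p-prime 2<p refl =
  subst (λ t → S n ≡ toℚ t [modℚ suc (2 ℕ.* h) ]) (sym re≡evenSum)
        (p-Integral.≋⇒≡[modℚ] p-prime (S n) (evenSum h n) (S≋ p-prime 2<p refl n 2n≤h))
  where
  n = suc (2 ℕ.* h) / 4
  2n≤h : 2 ℕ.* n ≤ h
  2n≤h = subst (λ m → 2 ℕ.* m ≤ h) (sym (quarter≡half h)) (proj₁ (half-bounds h))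
  h≤2n+1 : h ≤ suc (2 ℕ.* n)
  h≤2n+1 = subst (λ m → h ≤ suc (2 ℕ.* m)) (sym (quarter≡half h)) (proj₂ (half-bounds h))
  -- the summands of re h beyond n vanish, as then 2k > h
  vanish : ∀ k → n < k → evenTerm h k ≡ + 0
  vanish k n<k = evenTerm-vanish h k
    (≤-trans (s≤s h≤2n+1) (subst (_≤ 2 ℕ.* k) (twice-suc n) (*-monoʳ-≤ 2 n<k)))
  re≡evenSum : re h ≡ evenSum h n
  re≡evenSum = begin
    evenSum h h                ≡⟨ cong (evenSum h) (m∸n+n≡m (≤-trans (k≤2k n) 2n≤h)) ⟨
    evenSum h ((h ∸ n) ℕ.+ n)  ≡⟨ Σ≤-stable (evenTerm h) n vanish (h ∸ n) ⟩
    evenSum h n                ∎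

residue : ∀ p r → p % 8 ≡ r → p ≡ r ℕ.+ p / 8 ℕ.* 8
residue p r p%8≡r = trans (m≡m%n+[m/n]*n p 8) (cong (ℕ._+ p / 8 ℕ.* 8) p%8≡r)

re-period : ∀ m s → re (m ℕ.* 4 ℕ.+ s) ≡ -[1+ 3 ] ^ m * re s
re-period m s = cong proj₁ ([1+i]^-period m s)

residue-class : ∀ {p} m s → Prime p → 2 < p → p ≡ suc (2 ℕ.* (m ℕ.* 4 ℕ.+ s)) →
                ∀ {t} → -[1+ 3 ] ^ m * re s ≡ t → S (p / 4) ≡ toℚ t [modℚ p ]
residue-class {p} m s p-prime 2<p p≡2h+1 refl =
  subst (λ t → S (p / 4) ≡ toℚ t [modℚ p ]) (re-period m s) (S≡re {h = m ℕ.* 4 ℕ.+ s} p-prime 2<p p≡2h+1)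

eighth : ∀ m → m ℕ.* 8 / 8 ≡ m
eighth m = m*n/n≡m m 8

quarter : ∀ m → m ℕ.* 8 / 4 ≡ 2 ℕ.* m
quarter m = trans (cong (_/ 4) (regroup m)) (m*n/n≡m (2 ℕ.* m) 4)
  where
  regroup : ∀ m → m ℕ.* 8 ≡ 2 ℕ.* m ℕ.* 4
  regroup = ℕ-Solver.solve-∀

value-1-3 : ∀ m → -[1+ 3 ] ^ m * + 1 ≡ sign (m ℕ.* 8 / 8) * (+ 2) ^ (m ℕ.* 8 / 4)
value-1-3 m = begin
  -[1+ 3 ] ^ m * + 1              ≡⟨ *-identityʳ _ ⟩
  -[1+ 3 ] ^ m                    ≡⟨ [-4]^ m ⟩
  sign m * (+ 2) ^ (2 ℕ.* m)      ≡⟨ cong₂ (λ a b → sign a * (+ 2) ^ b) (eighth m) (quarter m) ⟨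
  sign (m ℕ.* 8 / 8) * (+ 2) ^ (m ℕ.* 8 / 4) ∎

case-1 : ∀ {p} m → p ≡ 1 ℕ.+ m ℕ.* 8 → Prime p → 2 < p →
         S (p / 4) ≡ toℚ (sign ((p ∸ 1) / 8) * (+ 2) ^ ((p ∸ 1) / 4)) [modℚ p ]
case-1 m refl p-prime 2<p = residue-class m 0 p-prime 2<p (shape m) (value-1-3 m)
  where
  shape : ∀ m → 1 ℕ.+ m ℕ.* 8 ≡ suc (2 ℕ.* (m ℕ.* 4 ℕ.+ 0))
  shape = ℕ-Solver.solve-∀

case-3 : ∀ {p} m → p ≡ 3 ℕ.+ m ℕ.* 8 → Prime p → 2 < p →
         S (p / 4) ≡ toℚ (sign ((p ∸ 3) / 8) * (+ 2) ^ ((p ∸ 3) / 4)) [modℚ p ]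
case-3 m refl p-prime 2<p = residue-class m 1 p-prime 2<p (shape m) (value-1-3 m)
  where
  shape : ∀ m → 3 ℕ.+ m ℕ.* 8 ≡ suc (2 ℕ.* (m ℕ.* 4 ℕ.+ 1))
  shape = ℕ-Solver.solve-∀

case-5 : ∀ {p} m → p ≡ 5 ℕ.+ m ℕ.* 8 → Prime p → 2 < p → S (p / 4) ≡ ℚ.0ℚ [modℚ p ]
case-5 m refl p-prime 2<p = residue-class m 2 p-prime 2<p (shape m) (*-zeroʳ (-[1+ 3 ] ^ m))
  where
  shape : ∀ m → 5 ℕ.+ m ℕ.* 8 ≡ suc (2 ℕ.* (m ℕ.* 4 ℕ.+ 2))
  shape = ℕ-Solver.solve-∀

case-7 : ∀ {p} m → p ≡ 7 ℕ.+ m ℕ.* 8 → Prime p → 2 < p →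
         S (p / 4) ≡ toℚ (sign ((p ℕ.+ 1) / 8) * (+ 2) ^ ((p ∸ 3) / 4)) [modℚ p ]
case-7 m refl p-prime 2<p = residue-class m 3 p-prime 2<p (shape m) value
  where
  shape : ∀ m → 7 ℕ.+ m ℕ.* 8 ≡ suc (2 ℕ.* (m ℕ.* 4 ℕ.+ 3))
  shape = ℕ-Solver.solve-∀
  regroup₈ : ∀ m → 7 ℕ.+ m ℕ.* 8 ℕ.+ 1 ≡ suc m ℕ.* 8
  regroup₈ = ℕ-Solver.solve-∀
  regroup₄ : ∀ m → 4 ℕ.+ m ℕ.* 8 ≡ suc (2 ℕ.* m) ℕ.* 4
  regroup₄ = ℕ-Solver.solve-∀
  double : ∀ s x → (s * x) * -[1+ 1 ] ≡ (-[1+ 0 ] * s) * (+ 2 * x)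
  double = solve-∀
  value : -[1+ 3 ] ^ m * -[1+ 1 ] ≡ sign ((7 ℕ.+ m ℕ.* 8 ℕ.+ 1) / 8) * (+ 2) ^ ((4 ℕ.+ m ℕ.* 8) / 4)
  value = begin
    -[1+ 3 ] ^ m * -[1+ 1 ]                                   ≡⟨ cong (_* -[1+ 1 ]) ([-4]^ m) ⟩
    sign m * (+ 2) ^ (2 ℕ.* m) * -[1+ 1 ]                     ≡⟨ double (sign m) ((+ 2) ^ (2 ℕ.* m)) ⟩
    sign (suc m) * (+ 2) ^ suc (2 ℕ.* m)                      ≡⟨ cong₂ (λ a b → sign a * (+ 2) ^ b)
                                                                   (trans (cong (_/ 8) (regroup₈ m)) (m*n/n≡m (suc m) 8))
                                                                   (trans (cong (_/ 4) (regroup₄ m)) (m*n/n≡m (suc (2 ℕ.* m)) 4)) ⟨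
    sign ((7 ℕ.+ m ℕ.* 8 ℕ.+ 1) / 8) * (+ 2) ^ ((4 ℕ.+ m ℕ.* 8) / 4) ∎

theorem2p4 : (p : ℕ) → Prime p → 5 < p →
    ((p % 8 ≡ 1 → S (p / 4) ≡ toℚ (((-[1+ 0 ]) ℤ.^ ((p ∸ 1) / 8)) ℤ.* ((+ 2) ℤ.^ ((p ∸ 1) / 4))) [modℚ p ])
    × (p % 8 ≡ 3 → S (p / 4) ≡ toℚ (((-[1+ 0 ]) ℤ.^ ((p ∸ 3) / 8)) ℤ.* ((+ 2) ℤ.^ ((p ∸ 3) / 4))) [modℚ p ])
    × (p % 8 ≡ 5 → S (p / 4) ≡ ℚ.0ℚ [modℚ p ])
    × (p % 8 ≡ 7 → S (p / 4) ≡ toℚ (((-[1+ 0 ]) ℤ.^ ((p ℕ.+ 1) / 8)) ℤ.* ((+ 2) ℤ.^ ((p ∸ 3) / 4))) [modℚ p ]))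
theorem2p4 p p-prime 5<p =
    (λ p%8≡1 → case-1 (p / 8) (residue p 1 p%8≡1) p-prime 2<p)
  , (λ p%8≡3 → case-3 (p / 8) (residue p 3 p%8≡3) p-prime 2<p)
  , (λ p%8≡5 → case-5 (p / 8) (residue p 5 p%8≡5) p-prime 2<p)
  , (λ p%8≡7 → case-7 (p / 8) (residue p 7 p%8≡7) p-prime 2<p)
  where
  2<p : 2 < p
  2<p = <-trans (s≤s (s≤s (s≤s z≤n))) 5<p
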